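{- Let $d\ge1$, $k_1,\dots,k_d\ge1$, $n=k_1+\dots+k_d$. For $1\le i\le d$ let $C_i=\mathrm{Circ}(c_{i,0},\dots,c_{i,k_i-1})\in\mathbb{C}^{k_i\times k_i}$, and for $i\ne j$ let $a_{i,j}\in\mathbb{C}$. Let $A$ be the $n\times n$ block matrix whose $(i,i)$ block is $C_i$ and whose $(i,j)$ block ($i\ne j$) is the $k_i\times k_j$ matrix with all entries $a_{i,j}$. For each $1\le i\le d$ and $1\le j\le k_i-1$, the vector $w_{i,j}$ is an eigenvector of $A$ with eigenvalue $\lambda_j^{C_i}=c_{i,0}+c_{i,k_i-1}\omega_{k_i}^j+c_{i,k_i-2}\omega_{k_i}^{2j}+\dots+c_{i,1}\omega_{k_i}^{(k_i-1)j}$. Furthermore, the system of $\sum_{i=1}^d k_i-d$ eigenvectors $\{w_{i,j}: 1\le i\le d,\ 1\le j\le k_i-1\}$ is linearly independent.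
   Context: $\mathrm{Circ}(c_0,\dots,c_{k-1})$ is the $k\times k$ matrix whose $(r,s)$ entry (indices $0,\dots,k-1$) is $c_{(r-s)\bmod k}$. $\omega_k$ denotes a fixed primitive $k$-th root of unity and $v_{k,j}=(1,\omega_k^j,\dots,\omega_k^{(k-1)j})^T$. The vector $w_{i,j}\in\mathbb{C}^n$ has coordinates $v_{k_i,j}$ in the $i$-th block (positions $k_1+\dots+k_{i-1}+1$ through $k_1+\dots+k_i$) and $0$ elsewhere. -}

module Defs where

open import Level using (Level)
open import Algebra.Bundles using (CommutativeRing)
open import Data.Nat as ℕ using (ℕ; zero; suc; NonZero; _∸_)
open import Data.Nat.DivMod using (_mod_)
open import Data.Fin as Fin using (Fin; toℕ; splitAt)
open import Data.Sum using (_⊎_; inj₁; inj₂)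
open import Data.Product using (Σ; _,_; _×_)
open import Relation.Nullary using (¬_)
open import Relation.Binary.PropositionalEquality using (_≡_)
open import Relation.Nullary using (yes; no)

total : ∀ {d} → (Fin d → ℕ) → ℕ
total {zero}  k = 0
total {suc d} k = k Fin.zero ℕ.+ total (λ i → k (Fin.suc i))

blockOf : ∀ {d} (k : Fin d → ℕ) → Fin (total k) → Σ (Fin d) (λ i → Fin (k i))
blockOf {suc d} k p with splitAt (k Fin.zero) p
... | inj₁ r = Fin.zero , r
... | inj₂ q with blockOf (λ i → k (Fin.suc i)) q
...   | i , r = Fin.suc i , r

module _ {c ℓ : Level} (R : CommutativeRing c ℓ) where
  open CommutativeRing R

  pow : Carrier → ℕ → Carrier
  pow x zero    = 1#
  pow x (suc m) = x * pow x m

  sumFin : ∀ {m} → (Fin m → Carrier) → Carrier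
  sumFin {zero}  f = 0#
  sumFin {suc m} f = f Fin.zero + sumFin (λ r → f (Fin.suc r))

  IsIntegralDomain : Set (c Level.⊔ ℓ)
  IsIntegralDomain = (¬ (1# ≈ 0#)) × (∀ x y → x * y ≈ 0# → (x ≈ 0#) ⊎ (y ≈ 0#))

  IsPrimitiveRoot : ℕ → Carrier → Set ℓ
  IsPrimitiveRoot m ω = (pow ω m ≈ 1#) × (∀ j → 1 ℕ.≤ j → j ℕ.< m → ¬ (pow ω j ≈ 1#))

  -- (r,s) entry of Circ(c₀,…,c_{k-1}) is c_{(r-s) mod k}
  circ : (k : ℕ) .{{_ : NonZero k}} → (Fin k → Carrier) → Fin k → Fin k → Carrier
  circ k cs r s = cs ((toℕ r ℕ.+ (k ∸ toℕ s)) mod k)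

  -- λ_j^{C} = c₀ + c_{k-1} ω^j + c_{k-2} ω^{2j} + … + c₁ ω^{(k-1)j}
  --         = Σ_{m<k} c_{(k-m) mod k} ω^{m j}
  circEigenvalue : (k : ℕ) .{{_ : NonZero k}} → (Fin k → Carrier) → Carrier → ℕ → Carrier
  circEigenvalue k cs ω j = sumFin (λ (m : Fin k) → cs ((k ∸ toℕ m) mod k) * pow ω (toℕ m ℕ.* j))

  blockMatrix : ∀ {d} (k : Fin d → ℕ) (nz : ∀ i → NonZero (k i))
              → ((i : Fin d) → Fin (k i) → Carrier)
              → (Fin d → Fin d → Carrier)
              → Fin (total k) → Fin (total k) → Carrier
  blockMatrix k nz cs a p q with blockOf k p | blockOf k q
  ... | i , r | i' , s with i Fin.≟ i'
  ...   | yes Relation.Binary.PropositionalEquality.refl = circ (k i) {{nz i}} (cs i) r s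
  ...   | no _ = a i i'

  wVec : ∀ {d} (k : Fin d → ℕ) → (ℕ → Carrier) → (i : Fin d) → ℕ → Fin (total k) → Carrier
  wVec k ω i j p with blockOf k p
  ... | i' , r with i' Fin.≟ i
  ...   | yes _ = pow (ω (k i')) (toℕ r ℕ.* j)
  ...   | no _  = 0#

  matVec : ∀ {n} → (Fin n → Fin n → Carrier) → (Fin n → Carrier) → Fin n → Carrier
  matVec M v p = sumFin (λ q → M p q * v q)

  IsEigenvector : ∀ {n} → (Fin n → Fin n → Carrier) → (Fin n → Carrier) → Carrier → Set ℓ
  IsEigenvector M v λ' = (∀ p → matVec M v p ≈ λ' * v p) × (¬ (∀ p → v p ≈ 0#))

  -- Σ_i Σ_{1≤j≤k_i-1} α_{i,j} w_{i,j}   (α i j' is the coefficient of w_{i,j'+1})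
  linComb : ∀ {d} (k : Fin d → ℕ) → (ℕ → Carrier)
          → ((i : Fin d) → Fin (k i ∸ 1) → Carrier) → Fin (total k) → Carrier
  linComb {d} k ω α p = sumFin (λ (i : Fin d) → sumFin (λ (j : Fin (k i ∸ 1)) → α i j * wVec k ω i (suc (toℕ j)) p))

{-# OPTIONS --safe #-}

-- The vector w_{i,j} is supported on block i, where it is v_{k_i,j} = (x^{sj})_s with
-- x = ω_{k_i}. In a row of block i, A acts on it as Circ(c_i), and Circ(c_i) v_{k_i,j} =
-- λ_j v_{k_i,j} because the circulant sum is a K-periodic sum that may be rotated to start
-- at the row index. In a row of another block i′ all relevant entries equal a_{i′,i}, so the
-- row reads a_{i′,i} ∑_s (x^j)^s = 0, a geometric sum of the root of unity x^j ≠ 1.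
-- For independence, the rows 0, …, k_i - 2 of block i of a vanishing combination say
-- ∑_b α_{i,b} (x^{b+1})^r = 0 for r < k_i - 1: a Vandermonde system with the distinct nodes
-- x^{b+1}, which over an integral domain has only the trivial solution.

module Submission where

open import Defs
open import Level using (Level)
open import Algebra.Bundles using (CommutativeRing)
open import Data.Nat as ℕ using (ℕ; zero; suc; NonZero; _≤_; _<_; _∸_; _%_; _/_; >-nonZero)
import Data.Nat.Properties as ℕₚ
open import Data.Nat.DivMod using (_mod_; m≡m%n+[m/n]*n; [m+n]%n≡m%n; [m+kn]%n≡m%n; m%n<n; m<n⇒m%n≡m)
open import Data.Fin as Fin using (Fin; toℕ; splitAt; join; _↑ˡ_; _↑ʳ_)
import Data.Fin.Properties as Finₚ
open import Data.Product using (Σ; _×_; _,_; proj₁; proj₂)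
open import Data.Sum as Sum using (_⊎_; inj₁; inj₂)
open import Function using (_∘_)
open import Function.Definitions using (Injective)
open import Relation.Nullary using (yes; no; ¬_; contradiction)
open import Relation.Binary.Definitions using (tri<; tri≈; tri>)
import Relation.Binary.PropositionalEquality as ≡
open ≡ using (_≡_; _≢_; refl)

rotate-index : ∀ K .{{_ : NonZero K}} m r → m ≤ K →
               r ℕ.+ (K ∸ (m ℕ.+ r) % K) ≡ (K ∸ m) ℕ.+ (m ℕ.+ r) / K ℕ.* K
rotate-index K m r m≤K = ℕₚ.+-cancelˡ-≡ m _ _ (begin
  m + (r + (K ∸ t))   ≡⟨ ℕₚ.+-assoc m r _ ⟨
  (m + r) + (K ∸ t)   ≡⟨ ≡.cong (_+ (K ∸ t)) (m≡m%n+[m/n]*n (m + r) K) ⟩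
  (t + q) + (K ∸ t)   ≡⟨ ≡.cong (_+ (K ∸ t)) (ℕₚ.+-comm t q) ⟩
  (q + t) + (K ∸ t)   ≡⟨ ℕₚ.+-assoc q t _ ⟩
  q + (t + (K ∸ t))   ≡⟨ ≡.cong (q +_) (ℕₚ.m+[n∸m]≡n (ℕₚ.<⇒≤ (m%n<n (m + r) K))) ⟩
  q + K               ≡⟨ ℕₚ.+-comm q K ⟩
  K + q               ≡⟨ ≡.cong (_+ q) (ℕₚ.m+[n∸m]≡n m≤K) ⟨
  (m + (K ∸ m)) + q   ≡⟨ ℕₚ.+-assoc m _ q ⟩
  m + ((K ∸ m) + q)   ∎)
  where
  open ≡.≡-Reasoning
  open import Data.Nat using (_+_)
  t = (m + r) % K
  q = (m + r) / K ℕ.* K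

-- circ K cs r s reads cs at (r + (K ∸ s)) mod K; in column s ≡ m + r (mod K) this is c_{-m}.
circ-index : ∀ K .{{_ : NonZero K}} m r → m ≤ K →
             (r ℕ.+ (K ∸ (m ℕ.+ r) % K)) mod K ≡ (K ∸ m) mod K
circ-index K m r m≤K = Finₚ.fromℕ<-cong _ _
  (≡.trans (≡.cong (_% K) (rotate-index K m r m≤K)) ([m+kn]%n≡m%n (K ∸ m) ((m ℕ.+ r) / K) K))
  (m%n<n _ K) (m%n<n _ K)

positionOf : ∀ {d} (k : Fin d → ℕ) → Σ (Fin d) (Fin ∘ k) → Fin (total k)
positionOf {suc d} k (Fin.zero  , r) = r ↑ˡ total (k ∘ Fin.suc)
positionOf {suc d} k (Fin.suc i , r) = k Fin.zero ↑ʳ positionOf (k ∘ Fin.suc) (i , r)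

blockOf-positionOf : ∀ {d} (k : Fin d → ℕ) ir → blockOf k (positionOf k ir) ≡ ir
blockOf-positionOf {suc d} k (Fin.zero , r)
  rewrite Finₚ.splitAt-↑ˡ (k Fin.zero) r (total (k ∘ Fin.suc)) = refl
blockOf-positionOf {suc d} k (Fin.suc i , r)
  rewrite Finₚ.splitAt-↑ʳ (k Fin.zero) (total (k ∘ Fin.suc)) (positionOf (k ∘ Fin.suc) (i , r))
        | blockOf-positionOf (k ∘ Fin.suc) (i , r) = refl

splitAt≡⇒join≡ : ∀ m {n} {p : Fin (m ℕ.+ n)} {x} → splitAt m p ≡ x → join m n x ≡ p
splitAt≡⇒join≡ m {n} {p} refl = Finₚ.join-splitAt m n p

positionOf-blockOf : ∀ {d} (k : Fin d → ℕ) p → positionOf k (blockOf k p) ≡ p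
positionOf-blockOf {suc d} k p with splitAt (k Fin.zero) p in eq
... | inj₁ r = splitAt≡⇒join≡ (k Fin.zero) eq
... | inj₂ q with blockOf (k ∘ Fin.suc) q | positionOf-blockOf (k ∘ Fin.suc) q
...   | i , r | ih = ≡.trans (≡.cong (k Fin.zero ↑ʳ_) ih) (splitAt≡⇒join≡ (k Fin.zero) eq)

module _ {c ℓ : Level} (R : CommutativeRing c ℓ) where

  open CommutativeRing R renaming (refl to ≈-refl)
  open import Algebra.Properties.Semiring.Sum semiring
  open import Algebra.Properties.Semiring.Exp semiring
  open import Algebra.Properties.Ring ring using ([y-z]x≈yx-zx; x[y-z]≈xy-xz)
  open import Algebra.Properties.Group +-group using (x∙y⁻¹≈ε⇒x≈y; x≈y⇒x∙y⁻¹≈ε)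
    renaming (∙-cancelˡ to +-cancelˡ; ∙-cancelʳ to +-cancelʳ)
  open import Algebra.Properties.AbelianGroup +-abelianGroup using (xyx⁻¹≈y)
  open import Algebra.Properties.CommutativeSemigroup *-commutativeSemigroup using (x∙yz≈y∙xz)
  open import Relation.Binary.Reasoning.Setoid setoid

  sumFin≡sum : ∀ {m} (f : Fin m → Carrier) → sumFin R f ≡ sum f
  sumFin≡sum {zero}  f = refl
  sumFin≡sum {suc m} f = ≡.cong (f Fin.zero +_) (sumFin≡sum (f ∘ Fin.suc))

  pow≡^ : ∀ x n → pow R x n ≡ x ^ n
  pow≡^ x zero    = refl
  pow≡^ x (suc n) = ≡.cong (x *_) (pow≡^ x n)

  1^n≈1 : ∀ n → 1# ^ n ≈ 1#
  1^n≈1 zero    = ≈-refl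
  1^n≈1 (suc n) = trans (*-identityˡ _) (1^n≈1 n)

  ^-multiple-of-order : ∀ {x} K j → x ^ K ≈ 1# → x ^ (K ℕ.* j) ≈ 1#
  ^-multiple-of-order {x} K j x^K≈1 = begin
    x ^ (K ℕ.* j)  ≈⟨ ^-assocʳ x K j ⟨
    (x ^ K) ^ j    ≈⟨ ^-congˡ j x^K≈1 ⟩
    1# ^ j         ≈⟨ 1^n≈1 j ⟩
    1#             ∎

  x[yz]≈w[xz]+[x[y-w]]z : ∀ x y z w → x * (y * z) ≈ w * (x * z) + (x * (y - w)) * z
  x[yz]≈w[xz]+[x[y-w]]z x y z w = begin
    t                       ≈⟨ xyx⁻¹≈y u t ⟨
    u + t - u               ≈⟨ +-assoc u t (- u) ⟩
    u + (t - u)             ≈⟨ +-congˡ difference ⟨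
    u + (x * (y - w)) * z   ∎
    where
    t = x * (y * z)
    u = w * (x * z)
    difference : (x * (y - w)) * z ≈ t - u
    difference = begin
      (x * (y - w)) * z         ≈⟨ *-assoc x (y - w) z ⟩
      x * ((y - w) * z)         ≈⟨ *-congˡ ([y-z]x≈yx-zx z y w) ⟩
      x * (y * z - w * z)       ≈⟨ x[y-z]≈xy-xz x (y * z) (w * z) ⟩
      x * (y * z) - x * (w * z) ≈⟨ +-congˡ (-‿cong (x∙yz≈y∙xz x w z)) ⟩
      t - u                     ∎

  sum-zero : ∀ {n} {f : Fin n → Carrier} → (∀ i → f i ≈ 0#) → sum f ≈ 0#
  sum-zero {n} f≈0 = trans (sum-cong-≋ f≈0) (sum-replicate-zero n)

  sum-single : ∀ {n} (f : Fin n → Carrier) i → (∀ j → j ≢ i → f j ≈ 0#) → sum f ≈ f i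
  sum-single {suc n} f i f≈0 = begin
    sum f                         ≈⟨ sum-remove {i = i} f ⟩
    f i + sum (f ∘ Fin.punchIn i) ≈⟨ +-congˡ (sum-zero (λ j → f≈0 _ (Finₚ.punchInᵢ≢i i j))) ⟩
    f i + 0#                      ≈⟨ +-identityʳ _ ⟩
    f i                           ∎

  sum-↑ˡ-↑ʳ : ∀ m {n} (f : Fin (m ℕ.+ n) → Carrier) → sum f ≈ sum (f ∘ (_↑ˡ n)) + sum (f ∘ (m ↑ʳ_))
  sum-↑ˡ-↑ʳ zero    f = sym (+-identityˡ _)
  sum-↑ˡ-↑ʳ (suc m) f = trans (+-congˡ (sum-↑ˡ-↑ʳ m (f ∘ Fin.suc))) (sym (+-assoc _ _ _))

  sum-blocks : ∀ {d} (k : Fin d → ℕ) (f : Fin (total k) → Carrier) →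
               sum f ≈ ∑[ i < d ] ∑[ r < k i ] f (positionOf k (i , r))
  sum-blocks {zero}  k f = ≈-refl
  sum-blocks {suc d} k f = trans (sum-↑ˡ-↑ʳ (k Fin.zero) f) (+-congˡ (sum-blocks (k ∘ Fin.suc) _))

  sum-snoc : ∀ (T : ℕ → Carrier) n → ∑[ s < suc n ] T (toℕ s) ≈ ∑[ s < n ] T (toℕ s) + T n
  sum-snoc T n = begin
    ∑[ s < suc n ] T (toℕ s)                                    ≈⟨ sum-init-last (T ∘ toℕ) ⟩
    ∑[ s < n ] T (toℕ (Fin.inject₁ s)) + T (toℕ (Fin.fromℕ n))
      ≡⟨ ≡.cong₂ _+_ (sum-cong-≗ {n} (≡.cong T ∘ Finₚ.toℕ-inject₁)) (≡.cong T (Finₚ.toℕ-fromℕ n)) ⟩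
    ∑[ s < n ] T (toℕ s) + T n                                  ∎

  sum-rotate : ∀ (T : ℕ → Carrier) n → T n ≈ T 0 → ∑[ s < n ] T (suc (toℕ s)) ≈ ∑[ s < n ] T (toℕ s)
  sum-rotate T n Tn≈T0 = +-cancelˡ (T 0) _ _ (begin
    ∑[ s < suc n ] T (toℕ s)    ≈⟨ sum-snoc T n ⟩
    ∑[ s < n ] T (toℕ s) + T n  ≈⟨ +-congˡ Tn≈T0 ⟩
    ∑[ s < n ] T (toℕ s) + T 0  ≈⟨ +-comm _ _ ⟩
    T 0 + ∑[ s < n ] T (toℕ s)  ∎)

  sum-shift-periodic : ∀ (T : ℕ → Carrier) n → (∀ s → T (s ℕ.+ n) ≈ T s) →
                       ∀ r → ∑[ s < n ] T (toℕ s ℕ.+ r) ≈ ∑[ s < n ] T (toℕ s)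
  sum-shift-periodic T n periodic zero =
    reflexive (sum-cong-≗ {n} (≡.cong T ∘ ℕₚ.+-identityʳ ∘ toℕ))
  sum-shift-periodic T n periodic (suc r) = begin
    (∑[ s < n ] T (toℕ s ℕ.+ suc r))    ≡⟨ sum-cong-≗ {n} (λ s → ≡.cong T (ℕₚ.+-suc (toℕ s) r)) ⟩
    (∑[ s < n ] T (suc (toℕ s ℕ.+ r)))  ≈⟨ sum-rotate (λ m → T (m ℕ.+ r)) n
                                             (trans (reflexive (≡.cong T (ℕₚ.+-comm n r))) (periodic r)) ⟩
    (∑[ s < n ] T (toℕ s ℕ.+ r))        ≈⟨ sum-shift-periodic T n periodic r ⟩
    ∑[ s < n ] T (toℕ s)                ∎

  geometric-series : ∀ x n → ∑[ s < n ] (x ^ toℕ s) + x ^ n ≈ 1# + x * ∑[ s < n ] (x ^ toℕ s)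
  geometric-series x n = begin
    ∑[ s < n ] (x ^ toℕ s) + x ^ n   ≈⟨ sum-snoc (x ^_) n ⟨
    1# + ∑[ s < n ] (x * x ^ toℕ s)  ≈⟨ +-congˡ (*-distribˡ-sum {n} x (λ s → x ^ toℕ s)) ⟨
    1# + x * ∑[ s < n ] (x ^ toℕ s)  ∎

  vandermonde-elimination : ∀ {N} (α y : Fin (suc N) → Carrier) r →
    ∑[ a < suc N ] (α a * y a ^ suc r)
      ≈ y Fin.zero * ∑[ a < suc N ] (α a * y a ^ r)
        + ∑[ a < N ] ((α (Fin.suc a) * (y (Fin.suc a) - y Fin.zero)) * y (Fin.suc a) ^ r)
  vandermonde-elimination {N} α y r = begin
    ∑[ a < suc N ] (α a * y a ^ suc r)
      ≈⟨ sum-cong-≋ {suc N} (λ a → x[yz]≈w[xz]+[x[y-w]]z (α a) (y a) (y a ^ r) y₀) ⟩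
    ∑[ a < suc N ] (y₀ * (α a * y a ^ r) + (α a * (y a - y₀)) * y a ^ r)
      ≈⟨ ∑-distrib-+ {suc N} (λ a → y₀ * (α a * y a ^ r)) (λ a → (α a * (y a - y₀)) * y a ^ r) ⟩
    ∑[ a < suc N ] (y₀ * (α a * y a ^ r)) + ((α Fin.zero * (y₀ - y₀)) * y₀ ^ r + rest)
      ≈⟨ +-cong (sym (*-distribˡ-sum {suc N} y₀ (λ a → α a * y a ^ r))) (+-congʳ first-term≈0) ⟩
    y₀ * ∑[ a < suc N ] (α a * y a ^ r) + (0# + rest)
      ≈⟨ +-congˡ (+-identityˡ rest) ⟩
    y₀ * ∑[ a < suc N ] (α a * y a ^ r) + rest
      ∎
    where
    y₀ = y Fin.zero
    rest = ∑[ a < N ] ((α (Fin.suc a) * (y (Fin.suc a) - y₀)) * y (Fin.suc a) ^ r)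
    first-term≈0 : (α Fin.zero * (y₀ - y₀)) * y₀ ^ r ≈ 0#
    first-term≈0 = trans (*-congʳ (trans (*-congˡ (-‿inverseʳ y₀)) (zeroʳ _))) (zeroˡ _)

  circEigenvalue≡sum : ∀ K .{{_ : NonZero K}} (cs : Fin K → Carrier) x j →
    circEigenvalue R K cs x j ≡ ∑[ m < K ] (cs ((K ∸ toℕ m) mod K) * x ^ (toℕ m ℕ.* j))
  circEigenvalue≡sum K cs x j =
    ≡.trans (sumFin≡sum {K} _) (sum-cong-≗ {K} (λ m → ≡.cong (_ *_) (pow≡^ x (toℕ m ℕ.* j))))

  -- The summand T is K-periodic, so the sum may start at s = r; then T (m + r) = U m · x^{rj}.
  circ-eigenvector : ∀ K .{{_ : NonZero K}} (cs : Fin K → Carrier) {x} → x ^ K ≈ 1# → ∀ j r →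
    ∑[ s < K ] (circ R K cs r s * x ^ (toℕ s ℕ.* j)) ≈ circEigenvalue R K cs x j * x ^ (toℕ r ℕ.* j)
  circ-eigenvector K cs {x} x^K≈1 j r = begin
    ∑[ s < K ] (circ R K cs r s * x ^ (toℕ s ℕ.* j))
      ≡⟨ sum-cong-≗ {K} (λ s → ≡.cong (λ t → cs ((r₀ ℕ.+ (K ∸ t)) mod K) * x ^ (toℕ s ℕ.* j))
                                      (≡.sym (m<n⇒m%n≡m (Finₚ.toℕ<n s)))) ⟩
    ∑[ s < K ] T (toℕ s)                        ≈⟨ sum-shift-periodic T K T-periodic r₀ ⟨
    ∑[ s < K ] T (toℕ s ℕ.+ r₀)                 ≈⟨ sum-cong-≋ {K} (λ m → T-shifted (toℕ m) (ℕₚ.<⇒≤ (Finₚ.toℕ<n m))) ⟩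
    ∑[ m < K ] (U (toℕ m) * x ^ (r₀ ℕ.* j))     ≈⟨ *-distribʳ-sum {K} (x ^ (r₀ ℕ.* j)) (U ∘ toℕ) ⟨
    ∑[ m < K ] U (toℕ m) * x ^ (r₀ ℕ.* j)       ≡⟨ ≡.cong (_* x ^ (r₀ ℕ.* j)) (circEigenvalue≡sum K cs x j) ⟨
    circEigenvalue R K cs x j * x ^ (r₀ ℕ.* j)  ∎
    where
    r₀ = toℕ r
    T U : ℕ → Carrier
    T s = cs ((r₀ ℕ.+ (K ∸ s % K)) mod K) * x ^ (s ℕ.* j)
    U m = cs ((K ∸ m) mod K) * x ^ (m ℕ.* j)

    x^[a+b]j : ∀ a b → x ^ ((a ℕ.+ b) ℕ.* j) ≈ x ^ (a ℕ.* j) * x ^ (b ℕ.* j)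
    x^[a+b]j a b = trans (reflexive (≡.cong (x ^_) (ℕₚ.*-distribʳ-+ j a b))) (^-homo-* x (a ℕ.* j) (b ℕ.* j))

    T-periodic : ∀ s → T (s ℕ.+ K) ≈ T s
    T-periodic s = *-cong
      (reflexive (≡.cong (λ t → cs ((r₀ ℕ.+ (K ∸ t)) mod K)) ([m+n]%n≡m%n s K)))
      (trans (x^[a+b]j s K) (trans (*-congˡ (^-multiple-of-order K j x^K≈1)) (*-identityʳ _)))

    T-shifted : ∀ m → m ≤ K → T (m ℕ.+ r₀) ≈ U m * x ^ (r₀ ℕ.* j)
    T-shifted m m≤K = trans
      (*-cong (reflexive (≡.cong cs (circ-index K m r₀ m≤K))) (x^[a+b]j m r₀))
      (sym (*-assoc _ _ _))

  module _ {K x} (isPrimitive : IsPrimitiveRoot R K x) where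

    primitive⇒^K≈1 : x ^ K ≈ 1#
    primitive⇒^K≈1 = ≡.subst (_≈ 1#) (pow≡^ x K) (proj₁ isPrimitive)

    primitive⇒^j≉1 : ∀ {j} → 1 ≤ j → j < K → x ^ j ≉ 1#
    primitive⇒^j≉1 {j} 1≤j j<K = proj₂ isPrimitive j 1≤j j<K ∘ ≡.subst (_≈ 1#) (≡.sym (pow≡^ x j))

    primitive⇒^-injective : ∀ {u v} → u < v → v < K → x ^ u ≉ x ^ v
    primitive⇒^-injective {u} {v} u<v v<K x^u≈x^v = primitive⇒^j≉1 1≤u+[K∸v] u+[K∸v]<K (begin
      x ^ (u ℕ.+ (K ∸ v))  ≈⟨ ^-homo-* x u (K ∸ v) ⟩
      x ^ u * x ^ (K ∸ v)  ≈⟨ *-congʳ x^u≈x^v ⟩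
      x ^ v * x ^ (K ∸ v)  ≈⟨ ^-homo-* x v (K ∸ v) ⟨
      x ^ (v ℕ.+ (K ∸ v))  ≡⟨ ≡.cong (x ^_) (ℕₚ.m+[n∸m]≡n (ℕₚ.<⇒≤ v<K)) ⟩
      x ^ K                ≈⟨ primitive⇒^K≈1 ⟩
      1#                   ∎)
      where
      1≤u+[K∸v] : 1 ≤ u ℕ.+ (K ∸ v)
      1≤u+[K∸v] = ℕₚ.≤-trans (ℕₚ.m<n⇒0<n∸m v<K) (ℕₚ.m≤n+m (K ∸ v) u)
      u+[K∸v]<K : u ℕ.+ (K ∸ v) < K
      u+[K∸v]<K = ℕₚ.<-≤-trans (ℕₚ.+-monoˡ-< (K ∸ v) u<v) (ℕₚ.≤-reflexive (ℕₚ.m+[n∸m]≡n (ℕₚ.<⇒≤ v<K)))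

  module _ {d} (k : Fin d → ℕ) where

    wVec-on : ∀ ω i j r → wVec R k ω i j (positionOf k (i , r)) ≡ ω (k i) ^ (toℕ r ℕ.* j)
    wVec-on ω i j r with blockOf k (positionOf k (i , r)) | blockOf-positionOf k (i , r)
    ... | _ | refl with i Fin.≟ i
    ...   | yes _  = pow≡^ (ω (k i)) (toℕ r ℕ.* j)
    ...   | no i≢i = contradiction refl i≢i

    wVec-off : ∀ ω i j {i′} r → i′ ≢ i → wVec R k ω i j (positionOf k (i′ , r)) ≡ 0#
    wVec-off ω i j {i′} r i′≢i with blockOf k (positionOf k (i′ , r)) | blockOf-positionOf k (i′ , r)
    ... | _ | refl with i′ Fin.≟ i
    ...   | yes i′≡i = contradiction i′≡i i′≢i
    ...   | no _     = refl

    module _ (nz : ∀ i → NonZero (k i)) (cs : (i : Fin d) → Fin (k i) → Carrier)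
             (a : Fin d → Fin d → Carrier) where

      blockMatrix-on : ∀ i r s → blockMatrix R k nz cs a (positionOf k (i , r)) (positionOf k (i , s))
                                 ≡ circ R (k i) {{nz i}} (cs i) r s
      blockMatrix-on i r s
        with blockOf k (positionOf k (i , r)) | blockOf-positionOf k (i , r)
           | blockOf k (positionOf k (i , s)) | blockOf-positionOf k (i , s)
      ... | _ | refl | _ | refl with i Fin.≟ i
      ...   | yes refl = refl
      ...   | no i≢i   = contradiction refl i≢i

      blockMatrix-off : ∀ {i i′} r s → i ≢ i′ →
                        blockMatrix R k nz cs a (positionOf k (i , r)) (positionOf k (i′ , s)) ≡ a i i′
      blockMatrix-off {i} {i′} r s i≢i′
        with blockOf k (positionOf k (i , r)) | blockOf-positionOf k (i , r)
           | blockOf k (positionOf k (i′ , s)) | blockOf-positionOf k (i′ , s)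
      ... | _ | refl | _ | refl with i Fin.≟ i′
      ...   | yes i≡i′ = contradiction i≡i′ i≢i′
      ...   | no _     = refl

    matVec-blockSupported : ∀ (M : Fin (total k) → Fin (total k) → Carrier) v i →
      (∀ {i′} s → i′ ≢ i → v (positionOf k (i′ , s)) ≈ 0#) →
      ∀ p → matVec R M v p ≈ ∑[ s < k i ] (M p (positionOf k (i , s)) * v (positionOf k (i , s)))
    matVec-blockSupported M v i v-supported p = begin
      matVec R M v p
        ≡⟨ sumFin≡sum (λ q → M p q * v q) ⟩
      ∑[ q < total k ] (M p q * v q)
        ≈⟨ sum-blocks k _ ⟩
      ∑[ i′ < d ] ∑[ s < k i′ ] (M p (positionOf k (i′ , s)) * v (positionOf k (i′ , s)))
        ≈⟨ sum-single _ i (λ i′ i′≢i → sum-zero (λ s → trans (*-congˡ (v-supported s i′≢i)) (zeroʳ _))) ⟩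
      ∑[ s < k i ] (M p (positionOf k (i , s)) * v (positionOf k (i , s))) ∎

    matVec-wVec : ∀ M ω i j p →
      matVec R M (wVec R k ω i j) p ≈ ∑[ s < k i ] (M p (positionOf k (i , s)) * ω (k i) ^ (toℕ s ℕ.* j))
    matVec-wVec M ω i j p = trans
      (matVec-blockSupported M (wVec R k ω i j) i (λ s i′≢i → reflexive (wVec-off ω i j s i′≢i)) p)
      (reflexive (sum-cong-≗ {k i} (λ s → ≡.cong (M p (positionOf k (i , s)) *_) (wVec-on ω i j s))))

    linComb-on : ∀ ω α i r → linComb R k ω α (positionOf k (i , r))
                               ≈ ∑[ b < k i ∸ 1 ] (α i b * ω (k i) ^ (toℕ r ℕ.* suc (toℕ b)))
    linComb-on ω α i r = begin
      linComb R k ω α p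
        ≡⟨ ≡.trans (sumFin≡sum {d} _)
                   (sum-cong-≗ {d} (λ i′ → sumFin≡sum (λ b → α i′ b * wVec R k ω i′ (suc (toℕ b)) p))) ⟩
      ∑[ i′ < d ] ∑[ b < k i′ ∸ 1 ] (α i′ b * wVec R k ω i′ (suc (toℕ b)) p)
        ≈⟨ sum-single _ i (λ i′ i′≢i → sum-zero {k i′ ∸ 1} (λ b →
             trans (*-congˡ (reflexive (wVec-off ω i′ (suc (toℕ b)) r (i′≢i ∘ ≡.sym)))) (zeroʳ _))) ⟩
      ∑[ b < k i ∸ 1 ] (α i b * wVec R k ω i (suc (toℕ b)) p)
        ≡⟨ sum-cong-≗ {k i ∸ 1} (λ b → ≡.cong (α i b *_) (wVec-on ω i (suc (toℕ b)) r)) ⟩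
      ∑[ b < k i ∸ 1 ] (α i b * ω (k i) ^ (toℕ r ℕ.* suc (toℕ b))) ∎
      where p = positionOf k (i , r)

  module _ (domain : IsIntegralDomain R) where

    *-cancelʳ-⊎ : ∀ {x y z} → x * z ≈ y * z → (x ≈ y) ⊎ (z ≈ 0#)
    *-cancelʳ-⊎ {x} {y} {z} xz≈yz = Sum.map₁ (x∙y⁻¹≈ε⇒x≈y x y)
      (proj₂ domain (x - y) z (trans ([y-z]x≈yx-zx z x y) (x≈y⇒x∙y⁻¹≈ε xz≈yz)))

    geometric-sum-root : ∀ {x} n → x ^ n ≈ 1# → x ≉ 1# → ∑[ s < n ] (x ^ toℕ s) ≈ 0#
    geometric-sum-root {x} n x^n≈1 x≉1 with *-cancelʳ-⊎ xG≈1G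
      where
      G = ∑[ s < n ] (x ^ toℕ s)
      xG≈1G : x * G ≈ 1# * G
      xG≈1G = sym (trans (*-identityˡ G) (+-cancelʳ 1# _ _ (begin
        G + 1#      ≈⟨ +-congˡ x^n≈1 ⟨
        G + x ^ n   ≈⟨ geometric-series x n ⟩
        1# + x * G  ≈⟨ +-comm 1# _ ⟩
        x * G + 1#  ∎)))
    ... | inj₁ x≈1 = contradiction x≈1 x≉1
    ... | inj₂ G≈0 = G≈0

    geometric-sum-primitive-root : ∀ {K x} → IsPrimitiveRoot R K x → ∀ {j} → 1 ≤ j → j < K →
                                   ∑[ s < K ] (x ^ (toℕ s ℕ.* j)) ≈ 0#
    geometric-sum-primitive-root {K} {x} isPrimitive {j} 1≤j j<K = begin
      ∑[ s < K ] (x ^ (toℕ s ℕ.* j))  ≈⟨ sum-cong-≋ {K} x^[sj]≈[x^j]^s ⟩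
      ∑[ s < K ] ((x ^ j) ^ toℕ s)    ≈⟨ geometric-sum-root K [x^j]^K≈1 (primitive⇒^j≉1 isPrimitive 1≤j j<K) ⟩
      0#                              ∎
      where
      x^[sj]≈[x^j]^s : ∀ s → x ^ (toℕ s ℕ.* j) ≈ (x ^ j) ^ toℕ s
      x^[sj]≈[x^j]^s s = trans (reflexive (≡.cong (x ^_) (ℕₚ.*-comm (toℕ s) j))) (sym (^-assocʳ x j (toℕ s)))
      [x^j]^K≈1 : (x ^ j) ^ K ≈ 1#
      [x^j]^K≈1 = begin
        (x ^ j) ^ K    ≈⟨ ^-assocʳ x j K ⟩
        x ^ (j ℕ.* K)  ≡⟨ ≡.cong (x ^_) (ℕₚ.*-comm j K) ⟩
        x ^ (K ℕ.* j)  ≈⟨ ^-multiple-of-order K j (primitive⇒^K≈1 isPrimitive) ⟩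
        1#             ∎

    vandermonde : ∀ {N} (α y : Fin N → Carrier) → Injective _≡_ _≈_ y →
                  (∀ r → r < N → ∑[ a < N ] (α a * y a ^ r) ≈ 0#) → ∀ a → α a ≈ 0#
    vandermonde {suc N} α y y-injective power-sums≈0 = α≈0
      where
      y₀ = y Fin.zero
      β : Fin N → Carrier
      β a = α (Fin.suc a) * (y (Fin.suc a) - y₀)

      β-power-sums≈0 : ∀ r → r < N → ∑[ a < N ] (β a * y (Fin.suc a) ^ r) ≈ 0#
      β-power-sums≈0 r r<N = begin
        ∑[ a < N ] (β a * y (Fin.suc a) ^ r)
          ≈⟨ +-identityˡ _ ⟨
        0# + ∑[ a < N ] (β a * y (Fin.suc a) ^ r)
          ≈⟨ +-congʳ (trans (*-congˡ (power-sums≈0 r (ℕₚ.m<n⇒m<1+n r<N))) (zeroʳ y₀)) ⟨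
        y₀ * ∑[ a < suc N ] (α a * y a ^ r) + ∑[ a < N ] (β a * y (Fin.suc a) ^ r)
          ≈⟨ vandermonde-elimination α y r ⟨
        ∑[ a < suc N ] (α a * y a ^ suc r)
          ≈⟨ power-sums≈0 (suc r) (ℕ.s≤s r<N) ⟩
        0# ∎

      α-tail≈0 : ∀ a → α (Fin.suc a) ≈ 0#
      α-tail≈0 a with proj₂ domain _ _
                        (vandermonde β (y ∘ Fin.suc) (Finₚ.suc-injective ∘ y-injective) β-power-sums≈0 a)
      ... | inj₁ α≈0     = α≈0
      ... | inj₂ y-y₀≈0 with y-injective (x∙y⁻¹≈ε⇒x≈y _ _ y-y₀≈0)
      ...   | ()

      α≈0 : ∀ a → α a ≈ 0#
      α≈0 Fin.zero = begin
        α Fin.zero                                         ≈⟨ *-identityʳ _ ⟨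
        α Fin.zero * 1#                                    ≈⟨ +-identityʳ _ ⟨
        α Fin.zero * 1# + 0#
          ≈⟨ +-congˡ (sum-zero (λ a → trans (*-congʳ (α-tail≈0 a)) (zeroˡ 1#))) ⟨
        α Fin.zero * 1# + ∑[ a < N ] (α (Fin.suc a) * 1#)  ≈⟨ power-sums≈0 0 (ℕ.s≤s ℕ.z≤n) ⟩
        0#                                                 ∎
      α≈0 (Fin.suc a) = α-tail≈0 a

    module _ {d} (k : Fin d → ℕ) (ω : ℕ → Carrier) where

      wVec-eigenvector : (nz : ∀ i → NonZero (k i)) (cs : (i : Fin d) → Fin (k i) → Carrier)
        (a : Fin d → Fin d → Carrier) → ∀ i {j} → IsPrimitiveRoot R (k i) (ω (k i)) → 1 ≤ j → j < k i →
        IsEigenvector R (blockMatrix R k nz cs a) (wVec R k ω i j) (circEigenvalue R (k i) {{nz i}} (cs i) (ω (k i)) j)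
      wVec-eigenvector nz cs a i {j} isPrimitive 1≤j j<k = eigen , nonzero
        where
        x = ω (k i)
        M = blockMatrix R k nz cs a
        w = wVec R k ω i j
        λᵢ = circEigenvalue R (k i) {{nz i}} (cs i) x j

        eigen-at : ∀ ir → matVec R M w (positionOf k ir) ≈ λᵢ * w (positionOf k ir)
        eigen-at (i′ , r) with i′ Fin.≟ i
        ... | yes refl = begin
          matVec R M w (positionOf k (i , r))
            ≈⟨ matVec-wVec k M ω i j _ ⟩
          ∑[ s < k i ] (M (positionOf k (i , r)) (positionOf k (i , s)) * x ^ (toℕ s ℕ.* j))
            ≡⟨ sum-cong-≗ {k i} (λ s → ≡.cong (_* x ^ (toℕ s ℕ.* j)) (blockMatrix-on k nz cs a i r s)) ⟩
          ∑[ s < k i ] (circ R (k i) {{nz i}} (cs i) r s * x ^ (toℕ s ℕ.* j))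
            ≈⟨ circ-eigenvector (k i) {{nz i}} (cs i) (primitive⇒^K≈1 isPrimitive) j r ⟩
          λᵢ * x ^ (toℕ r ℕ.* j)
            ≡⟨ ≡.cong (λᵢ *_) (wVec-on k ω i j r) ⟨
          λᵢ * w (positionOf k (i , r)) ∎
        ... | no i′≢i = begin
          matVec R M w (positionOf k (i′ , r))
            ≈⟨ matVec-wVec k M ω i j _ ⟩
          ∑[ s < k i ] (M (positionOf k (i′ , r)) (positionOf k (i , s)) * x ^ (toℕ s ℕ.* j))
            ≡⟨ sum-cong-≗ {k i} (λ s → ≡.cong (_* x ^ (toℕ s ℕ.* j)) (blockMatrix-off k nz cs a r s i′≢i)) ⟩
          ∑[ s < k i ] (a i′ i * x ^ (toℕ s ℕ.* j))
            ≈⟨ *-distribˡ-sum {k i} (a i′ i) (λ s → x ^ (toℕ s ℕ.* j)) ⟨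
          a i′ i * ∑[ s < k i ] (x ^ (toℕ s ℕ.* j))
            ≈⟨ *-congˡ (geometric-sum-primitive-root isPrimitive 1≤j j<k) ⟩
          a i′ i * 0#
            ≈⟨ trans (zeroʳ _) (sym (zeroʳ λᵢ)) ⟩
          λᵢ * 0#
            ≡⟨ ≡.cong (λᵢ *_) (wVec-off k ω i j r i′≢i) ⟨
          λᵢ * w (positionOf k (i′ , r)) ∎

        eigen : ∀ p → matVec R M w p ≈ λᵢ * w p
        eigen p = ≡.subst (λ q → matVec R M w q ≈ λᵢ * w q) (positionOf-blockOf k p) (eigen-at (blockOf k p))

        nonzero : ¬ (∀ p → w p ≈ 0#)
        nonzero w≈0 = proj₁ domain (begin
          1#                                      ≡⟨ ≡.cong (λ t → x ^ (t ℕ.* j)) (Finₚ.toℕ-fromℕ< 0<kᵢ) ⟨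
          x ^ (toℕ (Fin.fromℕ< 0<kᵢ) ℕ.* j)       ≡⟨ wVec-on k ω i j (Fin.fromℕ< 0<kᵢ) ⟨
          w (positionOf k (i , Fin.fromℕ< 0<kᵢ))  ≈⟨ w≈0 _ ⟩
          0#                                      ∎)
          where 0<kᵢ = ℕ.>-nonZero⁻¹ (k i) {{nz i}}

      wVec-independent : (∀ i → IsPrimitiveRoot R (k i) (ω (k i))) → (∀ i → 1 ≤ k i) →
        (α : (i : Fin d) → Fin (k i ∸ 1) → Carrier) → (∀ p → linComb R k ω α p ≈ 0#) → ∀ i b → α i b ≈ 0#
      wVec-independent isPrimitive hk α combination≈0 i = vandermonde (α i) y y-injective power-sums≈0
        where
        x = ω (k i)
        y : Fin (k i ∸ 1) → Carrier
        y b = x ^ suc (toℕ b)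

        suc-bound : ∀ b → suc (toℕ b) < k i
        suc-bound b = ≡.subst (_≤ k i) (ℕₚ.+-comm (suc (toℕ b)) 1)
                               (ℕₚ.m≤o∸n⇒m+n≤o (suc (toℕ b)) (hk i) (Finₚ.toℕ<n b))

        y-injective : Injective _≡_ _≈_ y
        y-injective {b} {b′} yb≈yb′ with ℕₚ.<-cmp (toℕ b) (toℕ b′)
        ... | tri< b<b′ _ _ = contradiction yb≈yb′
                                (primitive⇒^-injective (isPrimitive i) (ℕ.s≤s b<b′) (suc-bound b′))
        ... | tri≈ _ b≡b′ _ = Finₚ.toℕ-injective b≡b′
        ... | tri> _ _ b′<b = contradiction (sym yb≈yb′)
                                (primitive⇒^-injective (isPrimitive i) (ℕ.s≤s b′<b) (suc-bound b))

        power-sums≈0 : ∀ r → r < k i ∸ 1 → ∑[ b < k i ∸ 1 ] (α i b * y b ^ r) ≈ 0#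
        power-sums≈0 r r<kᵢ-1 = begin
          ∑[ b < k i ∸ 1 ] (α i b * y b ^ r)
            ≈⟨ sum-cong-≋ {k i ∸ 1} (λ b → *-congˡ (trans (^-assocʳ x (suc (toℕ b)) r)
                                                      (reflexive (≡.cong (x ^_) (ℕₚ.*-comm (suc (toℕ b)) r))))) ⟩
          ∑[ b < k i ∸ 1 ] (α i b * x ^ (r ℕ.* suc (toℕ b)))
            ≡⟨ sum-cong-≗ {k i ∸ 1} (λ b → ≡.cong (λ t → α i b * x ^ (t ℕ.* suc (toℕ b))) (Finₚ.toℕ-fromℕ< r<kᵢ)) ⟨
          ∑[ b < k i ∸ 1 ] (α i b * x ^ (toℕ r′ ℕ.* suc (toℕ b)))
            ≈⟨ linComb-on k ω α i r′ ⟨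
          linComb R k ω α (positionOf k (i , r′))
            ≈⟨ combination≈0 _ ⟩
          0# ∎
          where
          r<kᵢ : r < k i
          r<kᵢ = ℕₚ.<-≤-trans r<kᵢ-1 (ℕₚ.m∸n≤m (k i) 1)
          r′ = Fin.fromℕ< r<kᵢ

proposition3p1 : ∀ {c ℓ : Level} (R : CommutativeRing c ℓ) → let open CommutativeRing R in
    IsIntegralDomain R →
    (ω : ℕ → Carrier) → (∀ m → 1 ≤ m → IsPrimitiveRoot R m (ω m)) →
    (d : ℕ) → 1 ≤ d →
    (k : Fin d → ℕ) → (hk : ∀ i → 1 ≤ k i) →
    (cs : (i : Fin d) → Fin (k i) → Carrier) →
    (a : Fin d → Fin d → Carrier) →
    ((i : Fin d) → (j : ℕ) → 1 ≤ j → j < k i →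
       IsEigenvector R (blockMatrix R k (λ i → >-nonZero (hk i)) cs a)
         (wVec R k ω i j)
         (circEigenvalue R (k i) {{>-nonZero (hk i)}} (cs i) (ω (k i)) j))
    × ((α : (i : Fin d) → Fin (k i ∸ 1) → Carrier) →
       (∀ p → linComb R k ω α p ≈ 0#) →
       ∀ i j → α i j ≈ 0#)
proposition3p1 R domain ω isPrimitive d _ k hk cs a =
  (λ i j → wVec-eigenvector R domain k ω (λ i → >-nonZero (hk i)) cs a i (isPrimitiveₖ i)) ,
  wVec-independent R domain k ω isPrimitiveₖ hk
  where
  isPrimitiveₖ : ∀ i → IsPrimitiveRoot R (k i) (ω (k i))
  isPrimitiveₖ i = isPrimitive (k i) (hk i)
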